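{- Let $k\ge1$. For odd $n\ge1$, $t_k(n) = u_k(n)$, i.e., the number of length-$n$ words over $\Sigma_k$ having no nontrivial odd palindromic prefix equals the number of length-$n$ unbordered words over $\Sigma_k$. For even $n\ge 2$, $t_k(n) = k\,u_k(n-1)$.
   Context: $\Sigma_k=\{0,\ldots,k-1\}$. A palindrome is a word equal to its reverse; it is nontrivial if its length is at least $2$. A nontrivial odd palindromic prefix of $w$ is a prefix of $w$ (possibly $w$ itself) of odd length at least $3$ that is a palindrome. $t_k(n)$ is the number of length-$n$ words over $\Sigma_k$ with no nontrivial odd palindromic prefix. A border of $w$ is a word $u$ with $0<|u|<|w|$ that is both a prefix and a suffix of $w$; $u_k(n)$ is the number of length-$n$ words over $\Sigma_k$ having no border. -}

module Defs where

open import Data.Nat using (ℕ; zero; suc; _≤_; _<_; _∸_; _≤?_; _<?_)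
open import Data.Nat.Properties using (anyUpTo?)
open import Data.Nat using (_%_) renaming (_≟_ to _≟ℕ_)
open import Data.Fin using (Fin)
open import Data.Fin.Properties using () renaming (_≟_ to _≟ᶠ_)
open import Data.List using (List; []; _∷_; length; take; drop; reverse; filter; concatMap; map; allFin)
open import Data.List.Properties using (≡-dec)
open import Data.Product using (Σ; ∃; _×_; _,_)
open import Relation.Nullary using (Dec; yes; no; ¬_)
open import Relation.Nullary.Decidable using (_×-dec_; ¬?)
open import Relation.Binary.PropositionalEquality using (_≡_)

Odd : ℕ → Set
Odd m = m % 2 ≡ 1

Even : ℕ → Set
Even m = m % 2 ≡ 0

odd? : (m : ℕ) → Dec (Odd m)
odd? m = (m % 2) ≟ℕ 1

Word : ℕ → Set
Word k = List (Fin k)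

words : (k n : ℕ) → List (Word k)
words k zero    = [] ∷ []
words k (suc n) = concatMap (λ w → map (_∷ w) (allFin k)) (words k n)

Palindrome : ∀ {k} → Word k → Set
Palindrome w = reverse w ≡ w

HasNontrivialOddPalPrefix : ∀ {k} → Word k → Set
HasNontrivialOddPalPrefix w =
  ∃ λ m → m < suc (length w) × 3 ≤ m × Odd m × Palindrome (take m w)

HasBorder : ∀ {k} → Word k → Set
HasBorder w =
  ∃ λ m → m < length w × 0 < m × take m w ≡ drop (length w ∸ m) w

hasNontrivialOddPalPrefix? : ∀ {k} (w : Word k) → Dec (HasNontrivialOddPalPrefix w)
hasNontrivialOddPalPrefix? w =
  anyUpTo? (λ m → (3 ≤? m) ×-dec (odd? m ×-dec ≡-dec _≟ᶠ_ (reverse (take m w)) (take m w)))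
           (suc (length w))

hasBorder? : ∀ {k} (w : Word k) → Dec (HasBorder w)
hasBorder? w =
  anyUpTo? (λ m → (0 <? m) ×-dec ≡-dec _≟ᶠ_ (take m w) (drop (length w ∸ m) w)) (length w)

t : ℕ → ℕ → ℕ
t k n = length (filter (λ w → ¬? (hasNontrivialOddPalPrefix? w)) (words k n))

u : ℕ → ℕ → ℕ
u k n = length (filter (λ w → ¬? (hasBorder? w)) (words k n))

module Submission where

-- Both sequences obey recurrences obtained by growing words one letter at a time. Appending a letter
-- to a word creates a new nontrivial odd palindromic prefix only if the whole new word is an odd
-- palindrome, and a palindrome of length 2M + 1 has such a prefix of length at most 2M iff its first
-- M + 1 letters do; hence t(2M + 2) = k t(2M + 1) and t(2M + 1) + t(M + 1) = k t(2M). On the other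
-- side, a bordered word has a border at most half its length, so inserting a middle letter into x y
-- with |x| = |y| does not change borderedness, and with |x| = |y| + 1 only creates the border x;
-- hence u(2M + 1) = k u(2M) and u(2M) + u(M) = k u(2M − 1). Strong induction then gives
-- t(n + 1) = k u(n) for every n, which is both claims.
--
-- The halving of borders, and of palindromic prefixes of a palindrome (which are exactly its
-- borders), comes from one overlap argument: if a border u of w is longer than half of w, then w
-- also has the border of length 2|u| − |w| obtained by overlapping the two occurrences of u.

open import Defs
open import Data.Bool using (true; false; if_then_else_)
open import Data.Empty using (⊥-elim)
open import Data.Fin using (Fin; zero; suc)
import Data.Fin.Properties as Fin
open import Data.List
  using (List; []; _∷_; _++_; _∷ʳ_; length; map; concatMap; filter; allFin; tabulate; take; drop; reverse; initLast; _∷ʳ′_)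
open import Data.List.Properties
  using (map-++; map-tabulate; ++-monoid; ++-assoc; ++-cancelˡ; ++-conicalˡ; ∷-injective; ∷-injectiveˡ; ∷-injectiveʳ;
         length-++; length-++-≤ˡ; length-++-≤ʳ; length-take; length-reverse; take++drop≡id;
         reverse-++; reverse-involutive; unfold-reverse; ∷ʳ-++; ≡-dec)
open import Data.Nat using (ℕ; zero; suc; _+_; _*_; _∸_; _≤_; _<_; s≤s; z≤n; _≤?_; _<?_; _%_)
open import Data.Nat.DivMod using ([m+kn]%n≡m%n; m*n%n≡0)
open import Data.Nat.Induction using (<-wellFounded; <-rec)
open import Data.Nat.ListAction using (sum)
open import Data.Nat.ListAction.Properties using (sum-++)
open import Data.Nat.Properties
  using (+-*-semiring; suc-injective; +-comm; +-suc; +-identityʳ; *-zeroʳ; *-identityʳ; *-distribˡ-+;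
         +-cancelʳ-≡; +-cancelʳ-<; +-mono-≤; +-monoʳ-<;
         ≤-refl; ≤-reflexive; ≤-trans; ≤-antisym; ≤-pred; ≤-<-trans; <-trans; <-irrefl;
         <⇒≤; <⇒≱; <⇒≢; ≰⇒>; ≮⇒≥; m≤m+n; m≤n+m; m<m+n; n≤1+n;
         m∸n+n≡m; m+n∸n≡m; m<n⇒0<n∸m; m≤n⇒m⊓n≡m; module ≤-Reasoning)
open import Algebra.Properties.Semiring.Sum +-*-semiring
  using (sum-syntax; ∑-distrib-+; ∑-comm; sum-cong-≗; *-distribˡ-sum)
  renaming (sum to ∑)
open import Data.Nat.Tactic.RingSolver using (solve-∀)
open import Data.Product using (∃; _×_; _,_; proj₁; proj₂)
open import Data.Sum using (_⊎_; inj₁; inj₂; [_,_]; map₂)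
open import Function using (id; _∘_; _⇔_; mk⇔; Equivalence)
open import Function.Related.TypeIsomorphisms using (¬-cong-⇔)
open import Induction.WellFounded using (Acc; acc)
open import Relation.Binary.PropositionalEquality
  using (_≡_; _≢_; refl; sym; trans; cong; cong₂; subst; module ≡-Reasoning)
open import Relation.Nullary using (Dec; does; ¬_; yes; no)
open import Relation.Nullary.Decidable using (_×-dec_; _⊎-dec_; ¬?; does-⇔; dec-true; dec-false)
open import Relation.Unary using (Pred; Decidable)

parity : ∀ n → ∃ λ m → n ≡ m + m ⊎ n ≡ suc (m + m)
parity zero = 0 , inj₁ refl
parity (suc n) with parity n
... | m , inj₁ refl = m , inj₂ refl
... | m , inj₂ refl = suc m , inj₁ (cong suc (sym (+-suc m m)))

double≡*2 : ∀ m → m + m ≡ m * 2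
double≡*2 = solve-∀

¬odd-double : ∀ m → ¬ Odd (m + m)
¬odd-double m odd with () ← trans (sym odd) (trans (cong (_% 2) (double≡*2 m)) (m*n%n≡0 m 2))

odd-suc-double : ∀ m → Odd (suc (m + m))
odd-suc-double m = trans (cong (λ x → suc x % 2) (double≡*2 m)) ([m+kn]%n≡m%n 1 m 2)

suc-double+1 : ∀ m → suc (m + m) + 1 ≡ suc m + suc m
suc-double+1 = solve-∀

half-≤ : ∀ {m n} → m + m ≤ suc (n + n) → m ≤ n
half-≤ {m} {n} 2m≤1+2n with m ≤? n
... | yes m≤n = m≤n
... | no  m≰n = ⊥-elim (<-irrefl refl (subst (_≤ suc (n + n)) (cong suc (+-suc n n))
                                       (≤-trans (+-mono-≤ (≰⇒> m≰n) (≰⇒> m≰n)) 2m≤1+2n)))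

double-<⁻ : ∀ {m n} → m + m < n + n → m < n
double-<⁻ {m} {n} 2m<2n with m <? n
... | yes m<n = m<n
... | no  m≮n = ⊥-elim (<⇒≱ 2m<2n (+-mono-≤ (≮⇒≥ m≮n) (≮⇒≥ m≮n)))

0<-of-excess : ∀ {n L L′} → n < L + L → L′ + n ≡ L + L → 0 < L′
0<-of-excess {L′ = zero}  n<2L n≡2L = ⊥-elim (<⇒≢ n<2L n≡2L)
0<-of-excess {L′ = suc _} _    _    = s≤s z≤n

NontrivialOdd : ℕ → Set
NontrivialOdd L = ∃ λ q → 1 ≤ q × L ≡ suc (q + q)

nontrivialOdd : ∀ {L} → 3 ≤ L → Odd L → NontrivialOdd L
nontrivialOdd {L} 3≤L odd with parity L
... | q     , inj₁ refl = ⊥-elim (¬odd-double q odd)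
... | zero  , inj₂ refl = ⊥-elim (<⇒≱ 3≤L (s≤s z≤n))
... | suc q , inj₂ refl = suc q , s≤s z≤n , refl

nontrivialOdd⁻ : ∀ {L} → NontrivialOdd L → 3 ≤ L × Odd L
nontrivialOdd⁻ (q , 1≤q , refl) = s≤s (+-mono-≤ 1≤q 1≤q) , odd-suc-double q

-- For |V| = 2m + 1 and L = 2q + 1 the overlap step yields 2(2q − m) + 1, and 2q > m keeps it nontrivial.
nontrivialOdd-excess : ∀ {m L L′} → suc (m + m) + 1 < L + L → L′ + suc (m + m) ≡ L + L →
                       NontrivialOdd L → NontrivialOdd L′
nontrivialOdd-excess {m} {L′ = L′} long eq (q , _ , refl) =
  d , m<n⇒0<n∸m m<2q , +-cancelʳ-≡ (suc (m + m)) L′ (suc (d + d)) (begin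
    L′ + suc (m + m)          ≡⟨ eq ⟩
    suc (q + q) + suc (q + q) ≡⟨ cong (λ n → suc n + suc n) (sym (m∸n+n≡m (<⇒≤ m<2q))) ⟩
    suc (d + m) + suc (d + m) ≡⟨ regroup d m ⟩
    suc (d + d) + suc (m + m) ∎)
  where
  open ≡-Reasoning
  m<2q : m < q + q
  m<2q = ≤-pred (double-<⁻ (subst (_< suc (q + q) + suc (q + q)) (suc-double+1 m) long))
  d : ℕ
  d = q + q ∸ m
  regroup : ∀ d m → suc (d + m) + suc (d + m) ≡ suc (d + d) + suc (m + m)
  regroup = solve-∀

-- Indicators and sums over words

𝟙 : ∀ {p} {P : Set p} → Dec P → ℕ
𝟙 P? = if does P? then 1 else 0

module _ {p} {P : Set p} where

  𝟙-⇔ : ∀ {q} {Q : Set q} → P ⇔ Q → (P? : Dec P) (Q? : Dec Q) → 𝟙 P? ≡ 𝟙 Q?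
  𝟙-⇔ P⇔Q P? Q? = cong (λ b → if b then 1 else 0) (does-⇔ P⇔Q P? Q?)

  𝟙-× : ∀ {q} {Q : Set q} (P? : Dec P) (Q? : Dec Q) → 𝟙 (P? ×-dec Q?) ≡ 𝟙 P? * 𝟙 Q?
  𝟙-× (yes _) (yes _) = refl
  𝟙-× (yes _) (no _)  = refl
  𝟙-× (no _)  _       = refl

  𝟙-yes : (P? : Dec P) → P → 𝟙 P? ≡ 1
  𝟙-yes P? p = cong (λ b → if b then 1 else 0) (dec-true P? p)

  𝟙-no : (P? : Dec P) → ¬ P → 𝟙 P? ≡ 0
  𝟙-no P? ¬p = cong (λ b → if b then 1 else 0) (dec-false P? ¬p)

𝟙-¬-⊎ : ∀ {a b c} {A : Set a} {B : Set b} {C : Set c} → C ⇔ (A ⊎ B) →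
        (A? : Dec A) (B? : Dec B) (C? : Dec C) → 𝟙 (¬? C?) + 𝟙 (¬? A? ×-dec B?) ≡ 𝟙 (¬? A?)
𝟙-¬-⊎ C⇔A⊎B A? B? C? =
  trans (cong (_+ 𝟙 (¬? A? ×-dec B?)) (𝟙-⇔ (¬-cong-⇔ C⇔A⊎B) (¬? C?) (¬? (A? ⊎-dec B?)))) (split A? B?)
  where
  split : (A? : Dec _) (B? : Dec _) → 𝟙 (¬? (A? ⊎-dec B?)) + 𝟙 (¬? A? ×-dec B?) ≡ 𝟙 (¬? A?)
  split (yes _) _       = refl
  split (no _)  (yes _) = refl
  split (no _)  (no _)  = refl

∑-const : ∀ k c → ∑[ a < k ] c ≡ k * c
∑-const zero    c = refl
∑-const (suc k) c = cong (c +_) (∑-const k c)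

∑-single : ∀ {k} (f : Fin k → ℕ) b → (∀ a → a ≢ b → f a ≡ 0) → ∑ f ≡ f b
∑-single {suc k} f zero f≡0 = begin
  f zero + ∑[ a < k ] f (suc a) ≡⟨ cong (f zero +_) (sum-cong-≗ (λ a → f≡0 (suc a) λ ())) ⟩
  f zero + ∑[ a < k ] 0         ≡⟨ cong (f zero +_) (trans (∑-const k 0) (*-zeroʳ k)) ⟩
  f zero + 0                    ≡⟨ +-identityʳ (f zero) ⟩
  f zero                        ∎
  where open ≡-Reasoning
∑-single {suc k} f (suc b) f≡0 =
  cong₂ _+_ (f≡0 zero λ ()) (∑-single (f ∘ suc) b (λ a a≢b → f≡0 (suc a) (a≢b ∘ Fin.suc-injective)))

sum-tabulate : ∀ {k} (f : Fin k → ℕ) → sum (tabulate f) ≡ ∑ f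
sum-tabulate {zero}  f = refl
sum-tabulate {suc k} f = cong (f zero +_) (sum-tabulate (f ∘ suc))

module _ {k : ℕ} where

  sumWords : ℕ → (Word k → ℕ) → ℕ
  sumWords zero    f = f []
  sumWords (suc n) f = sumWords n (λ w → ∑[ a < k ] f (a ∷ w))

  sumWords-cong : ∀ n {f g : Word k → ℕ} → (∀ w → length w ≡ n → f w ≡ g w) → sumWords n f ≡ sumWords n g
  sumWords-cong zero    f≡g = f≡g [] refl
  sumWords-cong (suc n) f≡g = sumWords-cong n (λ w ∣w∣≡n → sum-cong-≗ (λ a → f≡g (a ∷ w) (cong suc ∣w∣≡n)))

  sumWords-+ : ∀ n (f g : Word k → ℕ) → sumWords n (λ w → f w + g w) ≡ sumWords n f + sumWords n g
  sumWords-+ zero    f g = refl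
  sumWords-+ (suc n) f g =
    trans (sumWords-cong n (λ w _ → ∑-distrib-+ (λ a → f (a ∷ w)) (λ a → g (a ∷ w)))) (sumWords-+ n _ _)

  sumWords-* : ∀ n c (f : Word k → ℕ) → sumWords n (λ w → c * f w) ≡ c * sumWords n f
  sumWords-* zero    c f = refl
  sumWords-* (suc n) c f =
    trans (sumWords-cong n (λ w _ → sym (*-distribˡ-sum c (λ a → f (a ∷ w))))) (sumWords-* n c _)

  sumWords-∑-const : ∀ n (f : Word k → ℕ) → sumWords n (λ w → ∑[ a < k ] f w) ≡ k * sumWords n f
  sumWords-∑-const n f = trans (sumWords-cong n (λ w _ → ∑-const k (f w))) (sumWords-* n k f)

  sumWords-∑ : ∀ n (f : Fin k → Word k → ℕ) → sumWords n (λ w → ∑[ a < k ] f a w) ≡ ∑[ a < k ] sumWords n (f a)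
  sumWords-∑ zero    f = refl
  sumWords-∑ (suc n) f =
    trans (sumWords-cong n (λ w _ → ∑-comm (λ b a → f a (b ∷ w)))) (sumWords-∑ n (λ a w → ∑[ b < k ] f a (b ∷ w)))

  sumWords-∷ʳ : ∀ n (f : Word k → ℕ) → sumWords (suc n) f ≡ sumWords n (λ w → ∑[ a < k ] f (w ∷ʳ a))
  sumWords-∷ʳ zero    f = refl
  sumWords-∷ʳ (suc n) f =
    trans (sumWords-∷ʳ n (λ w → ∑[ b < k ] f (b ∷ w))) (sumWords-cong n (λ w _ → ∑-comm (λ a b → f (b ∷ w ∷ʳ a))))

  sumWords-++ : ∀ m n (f : Word k → ℕ) → sumWords (m + n) f ≡ sumWords m (λ x → sumWords n (λ y → f (x ++ y)))
  sumWords-++ zero    n f = refl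
  sumWords-++ (suc m) n f = trans (sumWords-++ m n (λ w → ∑[ a < k ] f (a ∷ w)))
                                  (sumWords-cong m (λ x _ → sumWords-∑ n (λ a y → f (a ∷ x ++ y))))

  sumWords-single : ∀ n (f : Word k → ℕ) r → length r ≡ n →
                    (∀ w → length w ≡ n → w ≢ r → f w ≡ 0) → sumWords n f ≡ f r
  sumWords-single zero    f [] _ _ = refl
  sumWords-single (suc n) f (b ∷ r) ∣br∣≡1+n f≡0 = begin
    sumWords n (λ w → ∑[ a < k ] f (a ∷ w)) ≡⟨ sumWords-single n _ r (suc-injective ∣br∣≡1+n) off-r ⟩
    ∑[ a < k ] f (a ∷ r)                    ≡⟨ ∑-single (λ a → f (a ∷ r)) b off-b ⟩
    f (b ∷ r)                               ∎
    where
    open ≡-Reasoning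
    off-b : ∀ a → a ≢ b → f (a ∷ r) ≡ 0
    off-b a a≢b = f≡0 (a ∷ r) ∣br∣≡1+n (a≢b ∘ ∷-injectiveˡ)
    off-r : ∀ w → length w ≡ n → w ≢ r → ∑[ a < k ] f (a ∷ w) ≡ 0
    off-r w ∣w∣≡n w≢r = trans (sum-cong-≗ (λ a → f≡0 (a ∷ w) (cong suc ∣w∣≡n) (w≢r ∘ ∷-injectiveʳ)))
                              (trans (∑-const k 0) (*-zeroʳ k))

  sum-map-words : ∀ n (f : Word k → ℕ) → sum (map f (words k n)) ≡ sumWords n f
  sum-map-words zero    f = +-identityʳ (f [])
  sum-map-words (suc n) f = trans (sum-concatMap (words k n)) (sum-map-words n _)
    where
    prepend : ∀ w → sum (map f (map (_∷ w) (allFin k))) ≡ ∑[ a < k ] f (a ∷ w)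
    prepend w = trans (cong (sum ∘ map f) (map-tabulate id (_∷ w)))
                      (trans (cong sum (map-tabulate (_∷ w) f)) (sum-tabulate (λ a → f (a ∷ w))))
    sum-concatMap : ∀ ws → sum (map f (concatMap (λ w → map (_∷ w) (allFin k)) ws)) ≡
                           sum (map (λ w → ∑[ a < k ] f (a ∷ w)) ws)
    sum-concatMap []       = refl
    sum-concatMap (w ∷ ws) = trans (cong sum (map-++ f (map (_∷ w) (allFin k)) _))
                                   (trans (sum-++ (map f (map (_∷ w) (allFin k))) _) (cong₂ _+_ (prepend w) (sum-concatMap ws)))

  length-filter-words : ∀ {p} {P : Pred (Word k) p} (P? : Decidable P) n →
                        length (filter P? (words k n)) ≡ sumWords n (λ w → 𝟙 (P? w))
  length-filter-words P? n = trans (length-filter≡sum (words k n)) (sum-map-words n _)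
    where
    length-filter≡sum : ∀ ws → length (filter P? ws) ≡ sum (map (λ w → 𝟙 (P? w)) ws)
    length-filter≡sum []       = refl
    length-filter≡sum (w ∷ ws) with does (P? w)
    ... | true  = cong suc (length-filter≡sum ws)
    ... | false = length-filter≡sum ws

-- Prefixes, suffixes and borders

module _ {A : Set} where

  -- u ∣ˡ w and u ∣ʳ w say that u is a prefix, resp. a suffix, of w: divisibility in the free monoid.
  open import Algebra.Properties.Monoid.Divisibility (++-monoid A) public
    using (_∣ˡ_; _∣ʳ_; _,_; ε∣ˡ_; ∣ˡ-refl; ∣ʳ-refl; ∣ˡ-trans; x∣ˡxy; x∣ˡy⇒x∣ˡyz; x∣ʳy⇒x∣ʳzy; ∣ʳ-respʳ-≈)

  length-∣ˡ : ∀ {u w} → u ∣ˡ w → length u ≤ length w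
  length-∣ˡ {u} (s , refl) = length-++-≤ˡ u

  length-∣ʳ : ∀ {u w} → u ∣ʳ w → length u ≤ length w
  length-∣ʳ {u} (p , refl) = length-++-≤ʳ u {p}

  ∣ˡ-++⁻ : ∀ {u} x {y} → u ∣ˡ (x ++ y) → length u ≤ length x → u ∣ˡ x
  ∣ˡ-++⁻ {[]}    x       _        _             = ε∣ˡ x
  ∣ˡ-++⁻ {_ ∷ u} (_ ∷ x) (s , eq) (s≤s ∣u∣≤∣x∣) with refl , eq′ ← ∷-injective eq
    with s′ , eq″ ← ∣ˡ-++⁻ x (s , eq′) ∣u∣≤∣x∣ = s′ , cong (_ ∷_) eq″

  ∣ʳ-++⁻ : ∀ {u} x {y} → u ∣ʳ (x ++ y) → length u ≤ length y → u ∣ʳ y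
  ∣ʳ-++⁻ []      u∣ʳy         _       = u∣ʳy
  ∣ʳ-++⁻ (_ ∷ x) ([] , refl)  ∣u∣≤∣y∣ = ⊥-elim (<⇒≱ (s≤s (length-++-≤ʳ _ {x})) ∣u∣≤∣y∣)
  ∣ʳ-++⁻ (_ ∷ x) (_ ∷ p , eq) ∣u∣≤∣y∣ = ∣ʳ-++⁻ x (p , proj₂ (∷-injective eq)) ∣u∣≤∣y∣

  ∣ˡ-take : ∀ {u w} n → u ∣ˡ w → length u ≤ n → u ∣ˡ take n w
  ∣ˡ-take {[]}    n       _          _           = ε∣ˡ _
  ∣ˡ-take {a ∷ u} (suc n) (s , refl) (s≤s ∣u∣≤n) with s′ , eq ← ∣ˡ-take n (s , refl) ∣u∣≤n = s′ , cong (a ∷_) eq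

  ∣ˡ-∷ʳ⁻ : ∀ {u} w {a} → u ∣ˡ (w ∷ʳ a) → u ∣ˡ w ⊎ u ≡ w ∷ʳ a
  ∣ˡ-∷ʳ⁻ {[]}    w       _        = inj₁ (ε∣ˡ w)
  ∣ˡ-∷ʳ⁻ {_ ∷ u} []      (s , eq) with refl , eq′ ← ∷-injective eq with refl ← ++-conicalˡ u s eq′ = inj₂ refl
  ∣ˡ-∷ʳ⁻ {_ ∷ u} (_ ∷ w) (s , eq) with refl , eq′ ← ∷-injective eq with ∣ˡ-∷ʳ⁻ w (s , eq′)
  ... | inj₁ (s′ , eq″) = inj₁ (s′ , cong (_ ∷_) eq″)
  ... | inj₂ refl       = inj₂ refl

  ∣ˡ⇒take : ∀ {u w} → u ∣ˡ w → take (length u) w ≡ u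
  ∣ˡ⇒take {[]}    _          = refl
  ∣ˡ⇒take {a ∷ u} (s , refl) = cong (a ∷_) (∣ˡ⇒take (s , refl))

  ∣ʳ⇒drop : ∀ {u w} → u ∣ʳ w → drop (length w ∸ length u) w ≡ u
  ∣ʳ⇒drop {u} (p , refl) =
    trans (cong (λ n → drop n (p ++ u)) (trans (cong (_∸ length u) (length-++ p)) (m+n∸n≡m (length p) (length u))))
          (drop-length-++ p)
    where
    drop-length-++ : ∀ p → drop (length p) (p ++ u) ≡ u
    drop-length-++ []      = refl
    drop-length-++ (_ ∷ p) = drop-length-++ p

  ∣ˡ⇒≡ : ∀ {u w} → u ∣ˡ w → length u ≡ length w → u ≡ w
  ∣ˡ⇒≡ {[]}    ([] , refl) _         = refl
  ∣ˡ⇒≡ {a ∷ u} (s , refl)  ∣u∣≡∣w∣ = cong (a ∷_) (∣ˡ⇒≡ (s , refl) (suc-injective ∣u∣≡∣w∣))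

  ∣ʳ⇒≡ : ∀ {u w} → u ∣ʳ w → length u ≡ length w → u ≡ w
  ∣ʳ⇒≡ ([] , refl)    _         = refl
  ∣ʳ⇒≡ (_ ∷ p , refl) ∣u∣≡∣w∣ = ⊥-elim (<⇒≱ (s≤s (length-++-≤ʳ _ {p})) (≤-reflexive (sym ∣u∣≡∣w∣)))

  ++-overlap : ∀ {p u s} → p ++ u ≡ u ++ s → length p ≤ length u → ∃ λ v → p ++ v ≡ u × v ++ s ≡ u
  ++-overlap {p} {u} {s} eq ∣p∣≤∣u∣ with v , pv≡u ← ∣ˡ-++⁻ u (u , eq) ∣p∣≤∣u∣ =
    v , pv≡u , ++-cancelˡ p (v ++ s) u (trans (sym (++-assoc p v s)) (trans (cong (_++ s) pv≡u) (sym eq)))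

  Border : List A → List A → Set
  Border u w = u ∣ˡ w × u ∣ʳ w

  border-overlap : ∀ {u w} → Border u w → length w < length u + length u →
                   ∃ λ v → Border v w × length v + length w ≡ length u + length u
  border-overlap {u} {w} ((s , us≡w) , (p , pu≡w)) ∣w∣<2∣u∣ = shorter (++-overlap (trans pu≡w (sym us≡w)) ∣p∣≤∣u∣)
    where
    ∣w∣≡∣p∣+∣u∣ : length w ≡ length p + length u
    ∣w∣≡∣p∣+∣u∣ = trans (sym (cong length pu≡w)) (length-++ p)
    ∣p∣≤∣u∣ : length p ≤ length u
    ∣p∣≤∣u∣ = <⇒≤ (+-cancelʳ-< _ _ _ (subst (_< length u + length u) ∣w∣≡∣p∣+∣u∣ ∣w∣<2∣u∣))
    lengths : ∀ v p {u w} → w ≡ p + u → u ≡ p + v → v + w ≡ u + u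
    lengths v p refl refl = regroup v p
      where
      regroup : ∀ v p → v + (p + (p + v)) ≡ p + v + (p + v)
      regroup = solve-∀
    shorter : (∃ λ v → p ++ v ≡ u × v ++ s ≡ u) → ∃ λ v → Border v w × length v + length w ≡ length u + length u
    shorter (v , pv≡u , vs≡u) =
      v , ((s ++ s , trans (sym (++-assoc v s s)) (trans (cong (_++ s) vs≡u) us≡w))
          , (p ++ p , trans (++-assoc p p v) (trans (cong (p ++_) pv≡u) pu≡w)))
        , lengths (length v) (length p) ∣w∣≡∣p∣+∣u∣ (trans (sym (cong length pv≡u)) (length-++ p))

  -- The hypothesis on P says that P survives the overlap step L ↦ 2L − |w|.
  border-shrink : ∀ (P : ℕ → Set) e {w} →
                  (∀ {L L′} → length w + e < L + L → L′ + length w ≡ L + L → P L → P L′) →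
                  ∀ {u} → Border u w → length u < length w → P (length u) →
                  ∃ λ v → Border v w × P (length v) × length v + length v ≤ length w + e
  border-shrink P e {w} step = go (<-wellFounded _)
    where
    go : ∀ {u} → Acc _<_ (length u) → Border u w → length u < length w → P (length u) →
         ∃ λ v → Border v w × P (length v) × length v + length v ≤ length w + e
    go {u} (acc rec) u-border ∣u∣<∣w∣ Pu with length u + length u ≤? length w + e
    ... | yes short = u , u-border , Pu , short
    ... | no  long  = descend (border-overlap u-border (≤-<-trans (m≤m+n (length w) e) (≰⇒> long)))
      where
      descend : (∃ λ v → Border v w × length v + length w ≡ length u + length u) →
                ∃ λ v → Border v w × P (length v) × length v + length v ≤ length w + e
      descend (v , v-border , eq) = go (rec ∣v∣<∣u∣) v-border (<-trans ∣v∣<∣u∣ ∣u∣<∣w∣) (step (≰⇒> long) eq Pu)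
        where
        ∣v∣<∣u∣ : length v < length u
        ∣v∣<∣u∣ = +-cancelʳ-< _ _ _ (subst (_< length u + length w) (sym eq) (+-monoʳ-< (length u) ∣u∣<∣w∣))

-- Bordered words

module _ {k : ℕ} where

  hasBorder⇒border : ∀ {w : Word k} → HasBorder w → ∃ λ u → 0 < length u × length u < length w × Border u w
  hasBorder⇒border {w} (m , m<∣w∣ , 0<m , take≡drop) =
    take m w , subst (0 <_) (sym ∣u∣≡m) 0<m , subst (_< length w) (sym ∣u∣≡m) m<∣w∣ ,
    (drop m w , take++drop≡id m w) ,
    (take (length w ∸ m) w , trans (cong (take (length w ∸ m) w ++_) take≡drop) (take++drop≡id (length w ∸ m) w))
    where
    ∣u∣≡m : length (take m w) ≡ m
    ∣u∣≡m = trans (length-take m w) (m≤n⇒m⊓n≡m (<⇒≤ m<∣w∣))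

  border⇒hasBorder : ∀ {u w : Word k} → 0 < length u → length u < length w → Border u w → HasBorder w
  border⇒hasBorder {u} 0<∣u∣ ∣u∣<∣w∣ (u∣ˡw , u∣ʳw) =
    length u , ∣u∣<∣w∣ , 0<∣u∣ , trans (∣ˡ⇒take u∣ˡw) (sym (∣ʳ⇒drop u∣ʳw))

  ShortBorder : Word k → Set
  ShortBorder w = ∃ λ u → 0 < length u × length u + length u ≤ length w × Border u w

  hasBorder⇒shortBorder : ∀ {w : Word k} → HasBorder w → ShortBorder w
  hasBorder⇒shortBorder {w} hb = shorten (hasBorder⇒border hb)
    where
    nonempty : ∀ {L L′} → length w + 0 < L + L → L′ + length w ≡ L + L → 0 < L → 0 < L′
    nonempty {L} ∣w∣<2L eq _ = 0<-of-excess {L = L} (subst (_< L + L) (+-identityʳ (length w)) ∣w∣<2L) eq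
    shorten : (∃ λ u → 0 < length u × length u < length w × Border u w) → ShortBorder w
    shorten (u , 0<∣u∣ , ∣u∣<∣w∣ , u-border)
      with v , v-border , 0<∣v∣ , short ← border-shrink (0 <_) 0 nonempty u-border ∣u∣<∣w∣ 0<∣u∣ =
      v , 0<∣v∣ , subst (length v + length v ≤_) (+-identityʳ (length w)) short , v-border

  border-ends : ∀ {u} (x mid z : Word k) → Border u (x ++ mid ++ z) → length u ≤ length x → length u ≤ length z →
                u ∣ˡ x × u ∣ʳ z
  border-ends x mid z (u∣ˡw , u∣ʳw) ∣u∣≤∣x∣ ∣u∣≤∣z∣ =
    ∣ˡ-++⁻ x u∣ˡw ∣u∣≤∣x∣ , ∣ʳ-++⁻ (x ++ mid) (∣ʳ-respʳ-≈ (sym (++-assoc x mid z)) u∣ʳw) ∣u∣≤∣z∣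

  hasBorder-of-ends : ∀ {u} (x mid z : Word k) → 0 < length u → u ∣ˡ x → u ∣ʳ z → HasBorder (x ++ mid ++ z)
  hasBorder-of-ends {u} x mid z 0<∣u∣ u∣ˡx u∣ʳz =
    border⇒hasBorder 0<∣u∣ ∣u∣<∣w∣
      (x∣ˡy⇒x∣ˡyz (mid ++ z) u∣ˡx , ∣ʳ-respʳ-≈ (++-assoc x mid z) (x∣ʳy⇒x∣ʳzy (x ++ mid) u∣ʳz))
    where
    ∣u∣<∣w∣ : length u < length (x ++ mid ++ z)
    ∣u∣<∣w∣ = begin-strict
      length u                     <⟨ m<m+n (length u) 0<∣u∣ ⟩
      length u + length u          ≤⟨ +-mono-≤ (length-∣ˡ u∣ˡx) (≤-trans (length-∣ʳ u∣ʳz) (length-++-≤ʳ z {mid})) ⟩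
      length x + length (mid ++ z) ≡⟨ length-++ x ⟨
      length (x ++ mid ++ z)       ∎
      where open ≤-Reasoning

  hasBorder-middle : ∀ {h} (x mid mid′ z : Word k) → h ≤ length x → h ≤ length z → length (x ++ mid ++ z) ≤ suc (h + h) →
                     HasBorder (x ++ mid ++ z) → HasBorder (x ++ mid′ ++ z)
  hasBorder-middle x mid mid′ z h≤∣x∣ h≤∣z∣ ∣w∣≤1+2h = transfer ∘ hasBorder⇒shortBorder
    where
    transfer : ShortBorder (x ++ mid ++ z) → HasBorder (x ++ mid′ ++ z)
    transfer (u , 0<∣u∣ , short , u-border) =
      let ∣u∣≤h = half-≤ (≤-trans short ∣w∣≤1+2h)
          u∣ˡx , u∣ʳz = border-ends x mid z u-border (≤-trans ∣u∣≤h h≤∣x∣) (≤-trans ∣u∣≤h h≤∣z∣)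
      in hasBorder-of-ends x mid′ z 0<∣u∣ u∣ˡx u∣ʳz

  length-++-∷ : ∀ (x y : Word k) c → length (x ++ c ∷ y) ≡ suc (length x + length y)
  length-++-∷ x y c = trans (length-++ x) (+-suc (length x) (length y))

  hasBorder-insert : ∀ (x y : Word k) c → length x ≡ length y → HasBorder (x ++ c ∷ y) ⇔ HasBorder (x ++ y)
  hasBorder-insert x y c ∣x∣≡∣y∣ = mk⇔
    (hasBorder-middle x (c ∷ []) [] y ≤-refl (≤-reflexive ∣x∣≡∣y∣)
      (≤-reflexive (trans (length-++-∷ x y c) (cong (λ n → suc (length x + n)) (sym ∣x∣≡∣y∣)))))
    (hasBorder-middle x [] (c ∷ []) y ≤-refl (≤-reflexive ∣x∣≡∣y∣)
      (≤-trans (≤-reflexive (trans (length-++ x) (cong (length x +_) (sym ∣x∣≡∣y∣)))) (n≤1+n _)))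

  hasBorder-insert-off-centre : ∀ (x y : Word k) c → length x ≡ suc (length y) →
                                HasBorder (x ++ c ∷ y) ⇔ (HasBorder (x ++ y) ⊎ c ∷ y ≡ x)
  hasBorder-insert-off-centre x y c ∣x∣≡1+∣y∣ = mk⇔ (classify ∘ hasBorder⇒shortBorder) [ insert-middle , x-border ]
    where
    ∣y∣≤∣x∣ : length y ≤ length x
    ∣y∣≤∣x∣ = ≤-trans (n≤1+n _) (≤-reflexive (sym ∣x∣≡1+∣y∣))
    ∣w∣≡2∣x∣ : length (x ++ c ∷ y) ≡ suc (length y) + suc (length y)
    ∣w∣≡2∣x∣ = trans (length-++-∷ x y c) (trans (cong (λ n → suc (n + length y)) ∣x∣≡1+∣y∣) (cong suc (sym (+-suc _ _))))
    classify : ShortBorder (x ++ c ∷ y) → HasBorder (x ++ y) ⊎ c ∷ y ≡ x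
    classify (u , 0<∣u∣ , short , u-border) with length u ≤? length y
    ... | yes ∣u∣≤∣y∣ =
      let u∣ˡx , u∣ʳy = border-ends x (c ∷ []) y u-border (≤-trans ∣u∣≤∣y∣ ∣y∣≤∣x∣) ∣u∣≤∣y∣
      in inj₁ (hasBorder-of-ends x [] y 0<∣u∣ u∣ˡx u∣ʳy)
    ... | no  ∣u∣≰∣y∣ =
      let ∣u∣≡1+∣y∣ = ≤-antisym (half-≤ (≤-trans short (≤-trans (≤-reflexive ∣w∣≡2∣x∣) (n≤1+n _)))) (≰⇒> ∣u∣≰∣y∣)
          ∣u∣≡∣x∣ = trans ∣u∣≡1+∣y∣ (sym ∣x∣≡1+∣y∣)
          u∣ˡx , u∣ʳcy = border-ends x [] (c ∷ y) u-border (≤-reflexive ∣u∣≡∣x∣) (≤-reflexive ∣u∣≡1+∣y∣)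
      in inj₂ (trans (sym (∣ʳ⇒≡ u∣ʳcy ∣u∣≡1+∣y∣)) (∣ˡ⇒≡ u∣ˡx ∣u∣≡∣x∣))
    insert-middle : HasBorder (x ++ y) → HasBorder (x ++ c ∷ y)
    insert-middle = hasBorder-middle x [] (c ∷ []) y ∣y∣≤∣x∣ ≤-refl
                      (≤-reflexive (trans (length-++ x) (cong (_+ length y) ∣x∣≡1+∣y∣)))
    x-border : c ∷ y ≡ x → HasBorder (x ++ c ∷ y)
    x-border refl = hasBorder-of-ends (c ∷ y) [] (c ∷ y) (s≤s z≤n) ∣ˡ-refl ∣ʳ-refl

  hasBorder-++-tail : ∀ a (x : Word k) → HasBorder ((a ∷ x) ++ x) ⇔ HasBorder (a ∷ x)
  hasBorder-++-tail a x = mk⇔ (shrink ∘ hasBorder⇒shortBorder) (extend ∘ hasBorder⇒border)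
    where
    shrink : ShortBorder ((a ∷ x) ++ x) → HasBorder (a ∷ x)
    shrink (u , 0<∣u∣ , short , u-border) =
      let ∣u∣≤∣x∣ = half-≤ (≤-trans short (≤-reflexive (cong suc (length-++ x))))
          u∣ˡax , u∣ʳx = border-ends (a ∷ x) [] x u-border (≤-trans ∣u∣≤∣x∣ (n≤1+n _)) ∣u∣≤∣x∣
      in border⇒hasBorder 0<∣u∣ (s≤s ∣u∣≤∣x∣) (u∣ˡax , x∣ʳy⇒x∣ʳzy (a ∷ []) u∣ʳx)
    extend : (∃ λ u → 0 < length u × length u < length (a ∷ x) × Border u (a ∷ x)) → HasBorder ((a ∷ x) ++ x)
    extend (u , 0<∣u∣ , s≤s ∣u∣≤∣x∣ , u∣ˡax , u∣ʳax) =
      hasBorder-of-ends (a ∷ x) [] x 0<∣u∣ u∣ˡax (∣ʳ-++⁻ (a ∷ []) u∣ʳax ∣u∣≤∣x∣)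

-- Palindromic prefixes

module _ {k : ℕ} where

  NontrivialOddPalindrome : Word k → Set
  NontrivialOddPalindrome u = Palindrome u × NontrivialOdd (length u)

  hasNOPP⇔ : ∀ {w : Word k} → HasNontrivialOddPalPrefix w ⇔ (∃ λ u → u ∣ˡ w × NontrivialOddPalindrome u)
  hasNOPP⇔ {w} = mk⇔ to from
    where
    to : HasNontrivialOddPalPrefix w → ∃ λ u → u ∣ˡ w × NontrivialOddPalindrome u
    to (m , m≤∣w∣ , 3≤m , odd , pal) =
      take m w , (drop m w , take++drop≡id m w) , pal , subst NontrivialOdd (sym ∣u∣≡m) (nontrivialOdd 3≤m odd)
      where
      ∣u∣≡m : length (take m w) ≡ m
      ∣u∣≡m = trans (length-take m w) (m≤n⇒m⊓n≡m (≤-pred m≤∣w∣))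
    from : (∃ λ u → u ∣ˡ w × NontrivialOddPalindrome u) → HasNontrivialOddPalPrefix w
    from (u , u∣ˡw , pal , nontrivial) =
      let 3≤∣u∣ , odd = nontrivialOdd⁻ nontrivial
      in length u , s≤s (length-∣ˡ u∣ˡw) , 3≤∣u∣ , odd , subst Palindrome (sym (∣ˡ⇒take u∣ˡw)) pal

  hasNOPP-∣ˡ : ∀ {w v : Word k} → w ∣ˡ v → HasNontrivialOddPalPrefix w → HasNontrivialOddPalPrefix v
  hasNOPP-∣ˡ w∣ˡv hnp with u , u∣ˡw , u-nop ← Equivalence.to hasNOPP⇔ hnp =
    Equivalence.from hasNOPP⇔ (u , ∣ˡ-trans u∣ˡw w∣ˡv , u-nop)

  hasNOPP-∷ʳ : ∀ (w : Word k) a →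
               HasNontrivialOddPalPrefix (w ∷ʳ a) ⇔ (HasNontrivialOddPalPrefix w ⊎ NontrivialOddPalindrome (w ∷ʳ a))
  hasNOPP-∷ʳ w a =
    mk⇔ to [ hasNOPP-∣ˡ (x∣ˡxy w (a ∷ [])) , (λ nop → Equivalence.from hasNOPP⇔ (w ∷ʳ a , ∣ˡ-refl , nop)) ]
    where
    to : HasNontrivialOddPalPrefix (w ∷ʳ a) → HasNontrivialOddPalPrefix w ⊎ NontrivialOddPalindrome (w ∷ʳ a)
    to hnp with u , u∣ˡwa , u-nop ← Equivalence.to hasNOPP⇔ hnp with ∣ˡ-∷ʳ⁻ w u∣ˡwa
    ... | inj₁ u∣ˡw = inj₁ (Equivalence.from hasNOPP⇔ (u , u∣ˡw , u-nop))
    ... | inj₂ refl = inj₂ u-nop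

  length-∷ʳ : ∀ (w : Word k) a → length (w ∷ʳ a) ≡ suc (length w)
  length-∷ʳ w a = trans (length-++ w) (+-comm (length w) 1)

  hasNOPP-∷ʳ-even : ∀ (w : Word k) a → (3 ≤ suc (length w) → ¬ Odd (suc (length w))) →
                    HasNontrivialOddPalPrefix (w ∷ʳ a) ⇔ HasNontrivialOddPalPrefix w
  hasNOPP-∷ʳ-even w a even = mk⇔ ([ id , ⊥-elim ∘ ¬nontrivial ∘ proj₂ ] ∘ Equivalence.to (hasNOPP-∷ʳ w a))
                                 (Equivalence.from (hasNOPP-∷ʳ w a) ∘ inj₁)
    where
    ¬nontrivial : ¬ NontrivialOdd (length (w ∷ʳ a))
    ¬nontrivial nontrivial with 3≤L , odd ← nontrivialOdd⁻ nontrivial =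
      even (subst (3 ≤_) (length-∷ʳ w a) 3≤L) (subst Odd (length-∷ʳ w a) odd)

  hasNOPP-∷ʳ-odd : ∀ {j} (w : Word k) a → length w ≡ suc j + suc j →
                   HasNontrivialOddPalPrefix (w ∷ʳ a) ⇔ (HasNontrivialOddPalPrefix w ⊎ Palindrome (w ∷ʳ a))
  hasNOPP-∷ʳ-odd {j} w a ∣w∣≡2M = mk⇔ (map₂ proj₁ ∘ Equivalence.to (hasNOPP-∷ʳ w a))
                                       (Equivalence.from (hasNOPP-∷ʳ w a) ∘ map₂ (_, nontrivial))
    where
    nontrivial : NontrivialOdd (length (w ∷ʳ a))
    nontrivial = suc j , s≤s z≤n , trans (length-∷ʳ w a) (cong suc ∣w∣≡2M)

  reverse-++-∷ : ∀ (y r : Word k) c → reverse (y ++ c ∷ r) ≡ reverse r ++ c ∷ reverse y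
  reverse-++-∷ y r c = begin
    reverse (y ++ c ∷ r)         ≡⟨ reverse-++ y (c ∷ r) ⟩
    reverse (c ∷ r) ++ reverse y ≡⟨ cong (_++ reverse y) (unfold-reverse c r) ⟩
    reverse r ∷ʳ c ++ reverse y  ≡⟨ ∷ʳ-++ (reverse r) c (reverse y) ⟩
    reverse r ++ c ∷ reverse y   ∎
    where open ≡-Reasoning

  palindrome-++-∷ : ∀ (y r : Word k) c → length r ≡ length y → Palindrome (y ++ c ∷ r) ⇔ r ≡ reverse y
  palindrome-++-∷ y r c ∣r∣≡∣y∣ = mk⇔ to from
    where
    ∣cy∣≡∣cr∣ : length (c ∷ reverse y) ≡ length (c ∷ r)
    ∣cy∣≡∣cr∣ = cong suc (trans (length-reverse y) (sym ∣r∣≡∣y∣))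
    to : Palindrome (y ++ c ∷ r) → r ≡ reverse y
    to pal = sym (∷-injectiveʳ (∣ʳ⇒≡ (∣ʳ-++⁻ y (reverse r , trans (sym (reverse-++-∷ y r c)) pal) (≤-reflexive ∣cy∣≡∣cr∣))
                                       ∣cy∣≡∣cr∣))
    from : r ≡ reverse y → Palindrome (y ++ c ∷ r)
    from refl = trans (reverse-++-∷ y (reverse y) c) (cong (_++ c ∷ reverse y) (reverse-involutive y))

  palindrome-prefix⇒border : ∀ {u v : Word k} → Palindrome v → Palindrome u → u ∣ˡ v → Border u v
  palindrome-prefix⇒border {u} pal-v pal-u (s , refl) =
    (s , refl) , (reverse s , trans (cong (reverse s ++_) (sym pal-u)) (trans (sym (reverse-++ u s)) pal-v))

  palindrome-border⇒palindrome : ∀ {u v : Word k} → Palindrome v → Border u v → Palindrome u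
  palindrome-border⇒palindrome {u} pal-v ((s , refl) , (p , pu≡us)) =
    ∣ˡ⇒≡ (∣ˡ-++⁻ u (reverse p , trans (sym (reverse-++ p u)) (trans (cong reverse pu≡us) pal-v)) (≤-reflexive (length-reverse u)))
         (length-reverse u)

  palindrome-halfPrefix : ∀ {V : Word k} m → Palindrome V → length V ≡ suc (m + m) →
                          ∀ {u} → u ∣ˡ V → length u < length V → NontrivialOddPalindrome u →
                          ∃ λ v → v ∣ˡ V × length v ≤ suc m × NontrivialOddPalindrome v
  palindrome-halfPrefix {V} m pal-V ∣V∣≡1+2m u∣ˡV ∣u∣<∣V∣ (pal-u , odd-u) =
    shortest (border-shrink NontrivialOdd 1 step (palindrome-prefix⇒border pal-V pal-u u∣ˡV) ∣u∣<∣V∣ odd-u)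
    where
    step : ∀ {L L′} → length V + 1 < L + L → L′ + length V ≡ L + L → NontrivialOdd L → NontrivialOdd L′
    step {L} {L′} long eq = nontrivialOdd-excess {m} (subst (λ n → n + 1 < L + L) ∣V∣≡1+2m long)
                                                     (subst (λ n → L′ + n ≡ L + L) ∣V∣≡1+2m eq)
    shortest : (∃ λ v → Border v V × NontrivialOdd (length v) × length v + length v ≤ length V + 1) →
               ∃ λ v → v ∣ˡ V × length v ≤ suc m × NontrivialOddPalindrome v
    shortest (v , v-border , odd-v , short) =
      v , proj₁ v-border ,
      half-≤ (≤-trans short (≤-trans (≤-reflexive (trans (cong (_+ 1) ∣V∣≡1+2m) (suc-double+1 m))) (n≤1+n _))) ,
      palindrome-border⇒palindrome pal-V v-border , odd-v

  hasNOPP-firstHalf : ∀ {j} (w : Word k) a → Palindrome (w ∷ʳ a) → length w ≡ suc j + suc j →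
                      HasNontrivialOddPalPrefix w ⇔ HasNontrivialOddPalPrefix (take (suc (suc j)) w)
  hasNOPP-firstHalf {j} w a pal ∣w∣≡2M =
    mk⇔ (shorten ∘ Equivalence.to hasNOPP⇔) (hasNOPP-∣ˡ (drop (suc M) w , take++drop≡id (suc M) w))
    where
    M : ℕ
    M = suc j
    M+1≤∣w∣ : suc M ≤ length w
    M+1≤∣w∣ = ≤-trans (s≤s (m≤n+m M j)) (≤-reflexive (sym ∣w∣≡2M))
    shorten : (∃ λ u → u ∣ˡ w × NontrivialOddPalindrome u) → HasNontrivialOddPalPrefix (take (suc M) w)
    shorten (u , u∣ˡw , u-nop)
      with v , v∣ˡwa , ∣v∣≤M+1 , v-nop ← palindrome-halfPrefix M pal (trans (length-∷ʳ w a) (cong suc ∣w∣≡2M))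
                                            (∣ˡ-trans u∣ˡw (x∣ˡxy w (a ∷ [])))
                                            (≤-trans (s≤s (length-∣ˡ u∣ˡw)) (≤-reflexive (sym (length-∷ʳ w a)))) u-nop =
      Equivalence.from hasNOPP⇔ (v , ∣ˡ-take (suc M) (∣ˡ-++⁻ w v∣ˡwa (≤-trans ∣v∣≤M+1 M+1≤∣w∣)) ∣v∣≤M+1 , v-nop)

-- The recurrences

module _ (k : ℕ) where

  noNOPP? : (w : Word k) → Dec (¬ HasNontrivialOddPalPrefix w)
  noNOPP? w = ¬? (hasNontrivialOddPalPrefix? w)

  unbordered? : (w : Word k) → Dec (¬ HasBorder w)
  unbordered? w = ¬? (hasBorder? w)

  palindrome? : (w : Word k) → Dec (Palindrome w)
  palindrome? w = ≡-dec Fin._≟_ (reverse w) w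

  [noNOPP] [unbordered] : Word k → ℕ
  [noNOPP]     = 𝟙 ∘ noNOPP?
  [unbordered] = 𝟙 ∘ unbordered?

  t≡sumWords : ∀ n → t k n ≡ sumWords n [noNOPP]
  t≡sumWords = length-filter-words noNOPP?

  u≡sumWords : ∀ n → u k n ≡ sumWords n [unbordered]
  u≡sumWords = length-filter-words unbordered?

  t-suc : ∀ n → (3 ≤ suc n → ¬ Odd (suc n)) → t k (suc n) ≡ k * t k n
  t-suc n even = begin
    t k (suc n)                                     ≡⟨ t≡sumWords (suc n) ⟩
    sumWords (suc n) [noNOPP]                       ≡⟨ sumWords-∷ʳ n [noNOPP] ⟩
    sumWords n (λ w → ∑[ a < k ] [noNOPP] (w ∷ʳ a)) ≡⟨ sumWords-cong n (λ w ∣w∣≡n → sum-cong-≗ (no-new-prefix w ∣w∣≡n)) ⟩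
    sumWords n (λ w → ∑[ a < k ] [noNOPP] w)        ≡⟨ sumWords-∑-const n [noNOPP] ⟩
    k * sumWords n [noNOPP]                         ≡⟨ cong (k *_) (t≡sumWords n) ⟨
    k * t k n                                       ∎
    where
    open ≡-Reasoning
    no-new-prefix : ∀ w → length w ≡ n → ∀ a → [noNOPP] (w ∷ʳ a) ≡ [noNOPP] w
    no-new-prefix w refl a = 𝟙-⇔ (¬-cong-⇔ (hasNOPP-∷ʳ-even w a even)) (noNOPP? (w ∷ʳ a)) (noNOPP? w)

  palindromic-completions : ∀ (y : Word k) {n} → length y ≡ suc n → sumWords n (λ r → 𝟙 (palindrome? (y ++ r))) ≡ 1
  palindromic-completions y {n} ∣y∣≡1+n with initLast y
  ... | y₀ ∷ʳ′ c = begin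
    sumWords n (λ r → 𝟙 (palindrome? (y₀ ∷ʳ c ++ r))) ≡⟨ sumWords-cong n (λ r _ → cong (𝟙 ∘ palindrome?) (∷ʳ-++ y₀ c r)) ⟩
    sumWords n (λ r → 𝟙 (palindrome? (y₀ ++ c ∷ r)))  ≡⟨ sumWords-single n _ (reverse y₀) ∣ry₀∣≡n only-mirror ⟩
    𝟙 (palindrome? (y₀ ++ c ∷ reverse y₀))            ≡⟨ 𝟙-yes (palindrome? (y₀ ++ c ∷ reverse y₀)) mirror ⟩
    1                                                 ∎
    where
    open ≡-Reasoning
    ∣y₀∣≡n : length y₀ ≡ n
    ∣y₀∣≡n = suc-injective (trans (sym (length-∷ʳ y₀ c)) ∣y∣≡1+n)
    ∣ry₀∣≡n : length (reverse y₀) ≡ n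
    ∣ry₀∣≡n = trans (length-reverse y₀) ∣y₀∣≡n
    mirror : Palindrome (y₀ ++ c ∷ reverse y₀)
    mirror = Equivalence.from (palindrome-++-∷ y₀ (reverse y₀) c (length-reverse y₀)) refl
    only-mirror : ∀ r → length r ≡ n → r ≢ reverse y₀ → 𝟙 (palindrome? (y₀ ++ c ∷ r)) ≡ 0
    only-mirror r ∣r∣≡n r≢ry₀ =
      𝟙-no (palindrome? (y₀ ++ c ∷ r)) (r≢ry₀ ∘ Equivalence.to (palindrome-++-∷ y₀ r c (trans ∣r∣≡n (sym ∣y₀∣≡n))))

  -- A pair (w , a) with w ∷ʳ a a palindrome is determined by the first M + 1 letters of w, which also
  -- decide whether w has a nontrivial odd palindromic prefix.
  t-palindromic : ∀ j → sumWords (suc j + suc j) (λ w → ∑[ a < k ] 𝟙 (noNOPP? w ×-dec palindrome? (w ∷ʳ a))) ≡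
                        t k (suc (suc j))
  t-palindromic j = begin
    sumWords (M + M) (λ w → ∑[ a < k ] 𝟙 (noNOPP? w ×-dec palindrome? (w ∷ʳ a)))
      ≡⟨ sumWords-cong (M + M) (λ w ∣w∣≡2M → sum-cong-≗ (first-half w ∣w∣≡2M)) ⟩
    sumWords (M + M) (λ w → ∑[ a < k ] g (take (suc M) w) (w ∷ʳ a))
      ≡⟨ cong (λ n → sumWords n (λ w → ∑[ a < k ] g (take (suc M) w) (w ∷ʳ a))) (cong suc (+-suc j j)) ⟩
    sumWords (suc M + j) (λ w → ∑[ a < k ] g (take (suc M) w) (w ∷ʳ a))
      ≡⟨ sumWords-++ (suc M) j (λ w → ∑[ a < k ] g (take (suc M) w) (w ∷ʳ a)) ⟩
    sumWords (suc M) (λ y → sumWords j (λ z → ∑[ a < k ] g (take (suc M) (y ++ z)) ((y ++ z) ∷ʳ a)))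
      ≡⟨ sumWords-cong (suc M) (λ y ∣y∣≡M+1 → sumWords-cong j (λ z _ → sum-cong-≗ (λ a →
           cong₂ g (take-prefix y z ∣y∣≡M+1) (++-assoc y z (a ∷ []))))) ⟩
    sumWords (suc M) (λ y → sumWords j (λ z → ∑[ a < k ] g y (y ++ z ∷ʳ a)))
      ≡⟨ sumWords-cong (suc M) (λ y _ → sumWords-∷ʳ j (λ r → g y (y ++ r))) ⟨
    sumWords (suc M) (λ y → sumWords M (λ r → g y (y ++ r)))
      ≡⟨ sumWords-cong (suc M) unique-completion ⟩
    sumWords (suc M) [noNOPP]
      ≡⟨ t≡sumWords (suc M) ⟨
    t k (suc M) ∎
    where
    open ≡-Reasoning
    M : ℕ
    M = suc j
    g : Word k → Word k → ℕ
    g y v = 𝟙 (noNOPP? y ×-dec palindrome? v)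
    first-half : ∀ w → length w ≡ M + M → ∀ a → 𝟙 (noNOPP? w ×-dec palindrome? (w ∷ʳ a)) ≡ g (take (suc M) w) (w ∷ʳ a)
    first-half w ∣w∣≡2M a = 𝟙-⇔ (mk⇔ (λ (¬hnp , pal) → ¬hnp ∘ Equivalence.from (hasNOPP-firstHalf w a pal ∣w∣≡2M) , pal)
                                     (λ (¬hnp , pal) → ¬hnp ∘ Equivalence.to (hasNOPP-firstHalf w a pal ∣w∣≡2M) , pal))
                                (noNOPP? w ×-dec palindrome? (w ∷ʳ a)) (noNOPP? (take (suc M) w) ×-dec palindrome? (w ∷ʳ a))
    take-prefix : ∀ (y z : Word k) → length y ≡ suc M → take (suc M) (y ++ z) ≡ y
    take-prefix y z ∣y∣≡M+1 = trans (cong (λ n → take n (y ++ z)) (sym ∣y∣≡M+1)) (∣ˡ⇒take (x∣ˡxy y z))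
    unique-completion : ∀ y → length y ≡ suc M → sumWords M (λ r → g y (y ++ r)) ≡ [noNOPP] y
    unique-completion y ∣y∣≡M+1 = begin
      sumWords M (λ r → g y (y ++ r))                         ≡⟨ sumWords-cong M (λ r _ → 𝟙-× (noNOPP? y) (palindrome? (y ++ r))) ⟩
      sumWords M (λ r → [noNOPP] y * 𝟙 (palindrome? (y ++ r))) ≡⟨ sumWords-* M ([noNOPP] y) (λ r → 𝟙 (palindrome? (y ++ r))) ⟩
      [noNOPP] y * sumWords M (λ r → 𝟙 (palindrome? (y ++ r))) ≡⟨ cong ([noNOPP] y *_) (palindromic-completions y ∣y∣≡M+1) ⟩
      [noNOPP] y * 1                                          ≡⟨ *-identityʳ ([noNOPP] y) ⟩
      [noNOPP] y                                              ∎

  t-odd : ∀ j → t k (suc (suc j + suc j)) + t k (suc (suc j)) ≡ k * t k (suc j + suc j)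
  t-odd j = begin
    t k (suc (M + M)) + t k (suc M)
      ≡⟨ cong₂ _+_ (trans (t≡sumWords (suc (M + M))) (sumWords-∷ʳ (M + M) [noNOPP])) (sym (t-palindromic j)) ⟩
    sumWords (M + M) (λ w → ∑[ a < k ] [noNOPP] (w ∷ʳ a)) + sumWords (M + M) (λ w → ∑[ a < k ] g w a)
      ≡⟨ sumWords-+ (M + M) (λ w → ∑[ a < k ] [noNOPP] (w ∷ʳ a)) (λ w → ∑[ a < k ] g w a) ⟨
    sumWords (M + M) (λ w → ∑[ a < k ] [noNOPP] (w ∷ʳ a) + ∑[ a < k ] g w a)
      ≡⟨ sumWords-cong (M + M) (λ w ∣w∣≡2M → trans (sym (∑-distrib-+ (λ a → [noNOPP] (w ∷ʳ a)) (g w)))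
                                                  (sum-cong-≗ (split w ∣w∣≡2M))) ⟩
    sumWords (M + M) (λ w → ∑[ a < k ] [noNOPP] w)
      ≡⟨ sumWords-∑-const (M + M) [noNOPP] ⟩
    k * sumWords (M + M) [noNOPP]
      ≡⟨ cong (k *_) (t≡sumWords (M + M)) ⟨
    k * t k (M + M) ∎
    where
    open ≡-Reasoning
    M : ℕ
    M = suc j
    g : Word k → Fin k → ℕ
    g w a = 𝟙 (noNOPP? w ×-dec palindrome? (w ∷ʳ a))
    split : ∀ w → length w ≡ M + M → ∀ a → [noNOPP] (w ∷ʳ a) + g w a ≡ [noNOPP] w
    split w ∣w∣≡2M a = 𝟙-¬-⊎ (hasNOPP-∷ʳ-odd w a ∣w∣≡2M)
                             (hasNontrivialOddPalPrefix? w) (palindrome? (w ∷ʳ a)) (hasNontrivialOddPalPrefix? (w ∷ʳ a))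

  u-odd : ∀ m → u k (suc (m + m)) ≡ k * u k (m + m)
  u-odd m = begin
    u k (suc (m + m))
      ≡⟨ trans (u≡sumWords (suc (m + m))) (cong (λ n → sumWords n [unbordered]) (sym (+-suc m m))) ⟩
    sumWords (m + suc m) [unbordered]
      ≡⟨ sumWords-++ m (suc m) [unbordered] ⟩
    sumWords m (λ x → sumWords m (λ y → ∑[ c < k ] [unbordered] (x ++ c ∷ y)))
      ≡⟨ sumWords-cong m (λ x ∣x∣≡m → sumWords-cong m (λ y ∣y∣≡m →
           sum-cong-≗ (drop-middle x y (trans ∣x∣≡m (sym ∣y∣≡m))))) ⟩
    sumWords m (λ x → sumWords m (λ y → ∑[ c < k ] [unbordered] (x ++ y)))
      ≡⟨ sumWords-cong m (λ x _ → sumWords-∑-const m (λ y → [unbordered] (x ++ y))) ⟩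
    sumWords m (λ x → k * sumWords m (λ y → [unbordered] (x ++ y)))
      ≡⟨ sumWords-* m k (λ x → sumWords m (λ y → [unbordered] (x ++ y))) ⟩
    k * sumWords m (λ x → sumWords m (λ y → [unbordered] (x ++ y)))
      ≡⟨ cong (k *_) (trans (u≡sumWords (m + m)) (sumWords-++ m m [unbordered])) ⟨
    k * u k (m + m) ∎
    where
    open ≡-Reasoning
    drop-middle : ∀ x y → length x ≡ length y → ∀ c → [unbordered] (x ++ c ∷ y) ≡ [unbordered] (x ++ y)
    drop-middle x y ∣x∣≡∣y∣ c =
      𝟙-⇔ (¬-cong-⇔ (hasBorder-insert x y c ∣x∣≡∣y∣)) (unbordered? (x ++ c ∷ y)) (unbordered? (x ++ y))

  u-even : ∀ j → u k (suc j + suc j) + u k (suc j) ≡ k * u k (j + suc j)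
  u-even j = begin
    u k (M + M) + u k M
      ≡⟨ cong₂ _+_ (trans (u≡sumWords (M + M)) (sumWords-++ M M [unbordered]))
                   (trans (u≡sumWords M) (sumWords-cong M (λ x ∣x∣≡M → sym (tail-completion x ∣x∣≡M)))) ⟩
    sumWords M (λ x → sumWords M (λ r → [unbordered] (x ++ r))) + sumWords M (λ x → sumWords M (g x))
      ≡⟨ trans (sumWords-cong M (λ x _ → sumWords-+ M (λ r → [unbordered] (x ++ r)) (g x)))
               (sumWords-+ M (λ x → sumWords M (λ r → [unbordered] (x ++ r))) (λ x → sumWords M (g x))) ⟨
    sumWords M (λ x → sumWords M (λ r → [unbordered] (x ++ r) + g x r))
      ≡⟨ sumWords-cong M (λ x ∣x∣≡M → sumWords-cong M (split x ∣x∣≡M)) ⟩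
    sumWords M (λ x → sumWords j (λ y → ∑[ c < k ] [unbordered] (x ++ y)))
      ≡⟨ sumWords-cong M (λ x _ → sumWords-∑-const j (λ y → [unbordered] (x ++ y))) ⟩
    sumWords M (λ x → k * sumWords j (λ y → [unbordered] (x ++ y)))
      ≡⟨ sumWords-* M k (λ x → sumWords j (λ y → [unbordered] (x ++ y))) ⟩
    k * sumWords M (λ x → sumWords j (λ y → [unbordered] (x ++ y)))
      ≡⟨ cong (k *_) (trans (u≡sumWords (M + j)) (sumWords-++ M j [unbordered])) ⟨
    k * u k (M + j)
      ≡⟨ cong (λ n → k * u k n) (sym (+-suc j j)) ⟩
    k * u k (j + M) ∎
    where
    open ≡-Reasoning
    M : ℕ
    M = suc j
    g : Word k → Word k → ℕ
    g x r = 𝟙 (unbordered? (x ++ drop 1 r) ×-dec ≡-dec Fin._≟_ r x)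
    split : ∀ x → length x ≡ M → ∀ r → length r ≡ M → [unbordered] (x ++ r) + g x r ≡ [unbordered] (x ++ drop 1 r)
    split x ∣x∣≡M (c ∷ y) ∣cy∣≡M = 𝟙-¬-⊎ (hasBorder-insert-off-centre x y c (trans ∣x∣≡M (sym ∣cy∣≡M)))
                                         (hasBorder? (x ++ y)) (≡-dec Fin._≟_ (c ∷ y) x) (hasBorder? (x ++ c ∷ y))
    tail-completion : ∀ x → length x ≡ M → sumWords M (g x) ≡ [unbordered] x
    tail-completion x@(a ∷ x′) ∣x∣≡M = trans (sumWords-single M (g x) x ∣x∣≡M only-x)
                                             (𝟙-⇔ tail-irrelevant (unbordered? (x ++ x′) ×-dec ≡-dec Fin._≟_ x x) (unbordered? x))
      where
      only-x : ∀ r → length r ≡ M → r ≢ x → g x r ≡ 0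
      only-x r _ r≢x = 𝟙-no (unbordered? (x ++ drop 1 r) ×-dec ≡-dec Fin._≟_ r x) (r≢x ∘ proj₂)
      tail-irrelevant : (¬ HasBorder (x ++ x′) × x ≡ x) ⇔ (¬ HasBorder x)
      tail-irrelevant = mk⇔ (λ (¬hb , _) → ¬hb ∘ Equivalence.from (hasBorder-++-tail a x′))
                            (λ ¬hb → ¬hb ∘ Equivalence.to (hasBorder-++-tail a x′) , refl)

  t-suc≡k*u : ∀ n → t k (suc n) ≡ k * u k n
  t-suc≡k*u = <-rec _ step
    where
    step : ∀ n → (∀ {i} → i < n → t k (suc i) ≡ k * u k i) → t k (suc n) ≡ k * u k n
    step n ih with parity n
    ... | zero  , inj₁ refl = t-suc 0 λ { (s≤s ()) }
    ... | suc j , inj₁ refl = +-cancelʳ-≡ (k * u k M) (t k (suc (M + M))) (k * u k (M + M)) (begin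
      t k (suc (M + M)) + k * u k M   ≡⟨ cong (t k (suc (M + M)) +_) (ih (s≤s (m≤n+m M j))) ⟨
      t k (suc (M + M)) + t k (suc M) ≡⟨ t-odd j ⟩
      k * t k (M + M)                 ≡⟨ cong (k *_) (ih ≤-refl) ⟩
      k * (k * u k (j + M))           ≡⟨ cong (k *_) (u-even j) ⟨
      k * (u k (M + M) + u k M)       ≡⟨ *-distribˡ-+ k (u k (M + M)) (u k M) ⟩
      k * u k (M + M) + k * u k M     ∎)
      where
      open ≡-Reasoning
      M : ℕ
      M = suc j
    ... | m , inj₂ refl = begin
      t k (suc (suc (m + m))) ≡⟨ t-suc (suc (m + m)) (λ _ → ¬odd-double (suc m) ∘ subst Odd (cong suc (sym (+-suc m m)))) ⟩
      k * t k (suc (m + m))   ≡⟨ cong (k *_) (ih ≤-refl) ⟩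
      k * (k * u k (m + m))   ≡⟨ cong (k *_) (u-odd m) ⟨
      k * u k (suc (m + m))   ∎
      where open ≡-Reasoning

corollary8 : (k : ℕ) → 1 ≤ k →
    ((n : ℕ) → 1 ≤ n → Odd n → t k n ≡ u k n) ×
    ((n : ℕ) → 2 ≤ n → Even n → t k n ≡ k * u k (n ∸ 1))
corollary8 k _ = odd-length , even-length
  where
  odd-length : (n : ℕ) → 1 ≤ n → Odd n → t k n ≡ u k n
  odd-length n _ odd with parity n
  ... | m , inj₁ refl = ⊥-elim (¬odd-double m odd)
  ... | m , inj₂ refl = trans (t-suc≡k*u k (m + m)) (sym (u-odd k m))
  even-length : (n : ℕ) → 2 ≤ n → Even n → t k n ≡ k * u k (n ∸ 1)
  even-length n 2≤n even with parity n
  ... | zero  , inj₁ refl = ⊥-elim (<⇒≱ 2≤n z≤n)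
  ... | suc m , inj₁ refl = t-suc≡k*u k (m + suc m)
  ... | m     , inj₂ refl with () ← trans (sym even) (odd-suc-double m)
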